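{- Let $\ell\ge3$ be an integer and let $x_1=F_\ell<x_2<x_3<\cdots$ be the elements of $\overline{\mathcal{V}}_\ell$ listed in increasing order. Then the sequence $(x_{i+1}-x_i)_{i\ge1}=(F_{\ell-1},F_{\ell-1},F_{\ell-2},F_{\ell-2},F_{\ell-1},F_{\ell-1},\dots)$ is the infinite Fibonacci word $f_{u,v}$ constructed on the words $u=(F_{\ell-1},F_{\ell-1})$ and $v=(F_{\ell-2},F_{\ell-2})$.
   Context: Fibonacci numbers: $F_{ -1}=0$, $F_0=1$, $F_{i+2}=F_{i+1}+F_i$; $\overline{\mathcal{F}}=\{F_i: i\ge-1\}$. Define $\bar\iota:\mathbb{N}\to\mathbb{N}$ by $\bar\iota(x)=x$ if $x\in\overline{\mathcal{F}}$, and $\bar\iota(x)=x-2F_{i-2}$ if $F_i<x<F_{i+1}$ for an integer $i\ge3$; $\bar\alpha(x)=\lim_{k}\bar\iota^k(x)$; $\overline{\mathcal{V}}_\ell=\{x\in\mathbb{N}: \bar\alpha(x)\ge F_\ell\}$. For words $u,v$ over an alphabet, the infinite Fibonacci word $f_{u,v}$ is the limit of the sequence $(y_i)_{i\ge1}$ with $y_1=u$, $y_2=uv$, $y_{i+2}=y_{i+1}y_i$ (each $y_i$ is a prefix of $y_{i+1}$); so $f_{u,v}=uvuuvuvu\cdots$. -}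

module Defs where

open import Data.Nat using (ℕ; zero; suc; _+_; _*_; _∸_; _≤_; _<_; _≥_; _≟_; _<?_)
open import Data.List using (List; []; _∷_; _++_)
open import Data.Maybe using (Maybe; just; nothing)
open import Data.Product using (Σ; ∃; _×_; _,_)
open import Data.Sum using (_⊎_)
open import Relation.Nullary using (yes; no)
open import Relation.Binary.PropositionalEquality using (_≡_)
open import Function using (_∘_)

-- F i = F_i of the paper for i ≥ 0  (F_0 = 1, F_1 = 1, F_2 = 2, ...).
-- The paper's F_{-1} = 0 is handled separately in InFib.
F : ℕ → ℕ
F zero = 1
F (suc zero) = 1
F (suc (suc i)) = F (suc i) + F i

InFib : ℕ → Set
InFib x = (x ≡ 0) ⊎ (∃ λ i → F i ≡ x)

-- \bar ι, computed by scanning i = 0,1,2,...; fuel x+1 suffices since F i ≥ i.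
ιscan : ℕ → ℕ → ℕ → ℕ
ιscan zero i x = x
ιscan (suc fuel) i x with F i ≟ x
... | yes _ = x
... | no _ with F i <? x | x <? F (suc i)
...   | yes _ | yes _ = x ∸ 2 * F (i ∸ 2)
...   | _     | _     = ιscan fuel (suc i) x

ιbar : ℕ → ℕ
ιbar zero = zero
ιbar (suc x) = ιscan (suc (suc x)) 0 (suc x)

iterate : (ℕ → ℕ) → ℕ → ℕ → ℕ
iterate f zero x = x
iterate f (suc k) x = f (iterate f k x)

AlphaIs : ℕ → ℕ → Set
AlphaIs x y = ∃ λ K → ∀ k → K ≤ k → iterate ιbar k x ≡ y

InV : ℕ → ℕ → Set
InV ℓ x = ∃ λ y → AlphaIs x y × F ℓ ≤ y

-- finite Fibonacci words: fibY u v n = y_{n+1}  (y_1 = u, y_2 = uv, y_{i+2} = y_{i+1} y_i)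
fibY : {A : Set} → List A → List A → ℕ → List A
fibY u v zero = u
fibY u v (suc zero) = u ++ v
fibY u v (suc (suc n)) = fibY u v (suc n) ++ fibY u v n

nth : {A : Set} → List A → ℕ → Maybe A
nth [] k = nothing
nth (a ∷ as) zero = just a
nth (a ∷ as) (suc k) = nth as k

-- an infinite word s : ℕ → A equals f_{u,v} (the limit of the y_n):
-- every letter of every y_n agrees with s at that position
IsFibWord : {A : Set} → List A → List A → (ℕ → A) → Set
IsFibWord u v s = ∀ n k a → nth (fibY u v n) k ≡ just a → s k ≡ a

StrictlyIncreasing : (ℕ → ℕ) → Set
StrictlyIncreasing x = ∀ i → x i < x (suc i)

-- x enumerates \overline{V}_ℓ in increasing order (x 0 is the paper's x_1)
EnumeratesV : ℕ → (ℕ → ℕ) → Set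
EnumeratesV ℓ x = StrictlyIncreasing x × (∀ y → InV ℓ y → ∃ λ i → x i ≡ y) × (∀ i → InV ℓ (x i))

{-# OPTIONS --safe #-}
-- ι̅ fixes 0 and the Fibonacci numbers and maps F_i < x < F_{i+1} to x − 2F_{i−2} < x, so α̅ is
-- constant along ι̅-orbits: V̄_ℓ is ι̅-invariant, has no element below F_ℓ, and on a gap
-- (F_{j+2}, F_{j+3}) it is the translate by 2F_j of its trace on (F_{j−1}, F_{j+1} + F_{j−1}).
-- Composing such shifts gives the translation property: for ℓ ≤ n + 1 and
-- F_ℓ ≤ z ≤ F_{n+2} + F_n, z ∈ V̄_ℓ iff z + 2F_{n+1} ∈ V̄_ℓ.  From F_ℓ on, the gaps between
-- consecutive elements of V̄_ℓ begin with y_1 = u and y_2 = uv (checked directly).  Since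
-- y_{n+2} = y_{n+1} y_n and the letters of y_{n+1} sum to 2F_{n+ℓ−1}, the translation property
-- carries the gap pattern y_n from F_ℓ to the end of y_{n+1}; so the gaps follow every y_n.
-- Prefix sums of the nested words y_n enumerate V̄_ℓ, and every increasing enumeration of V̄_ℓ
-- has to step through exactly these gaps.
module Submission where

open import Defs
open import Data.Nat using (ℕ; zero; suc; _+_; _*_; _∸_; _≤_; _<_; z≤n; s≤s; z<s; _≟_; _<?_; >-nonZero)
open import Data.Nat.Properties
open import Data.Nat.Induction using (<-rec)
open import Algebra.Properties.CommutativeSemigroup +-commutativeSemigroup using (xy∙z≈xz∙y)
open import Data.Nat.ListAction using (sum)
open import Data.Nat.ListAction.Properties using (sum-++)
open import Data.Nat.Tactic.RingSolver using (solve-∀)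
open import Data.List using (List; []; _∷_; _++_; take; length)
open import Data.List.Properties using (length-++; ++-identityʳ; ++-assoc)
open import Data.List.Relation.Unary.All using (All; []; _∷_)
open import Data.Maybe using (just)
open import Data.Product using (∃; _×_; _,_; map₂; map₁)
open import Data.Sum using (_⊎_; inj₁; inj₂)
open import Data.Empty using (⊥-elim)
open import Function.Bundles using (_⇔_; mk⇔; Equivalence)
open import Function.Properties.Equivalence using () renaming (sym to ⇔-sym; trans to ⇔-trans)
open import Relation.Nullary using (¬_; yes; no)
open import Relation.Binary using (tri<; tri≈; tri>)
open import Relation.Binary.PropositionalEquality
  using (_≡_; refl; sym; trans; cong; cong₂; subst; subst₂; module ≡-Reasoning)

open Equivalence using (to; from)

step-mono-≤ : (f : ℕ → ℕ) → (∀ n → f n ≤ f (suc n)) → ∀ {i j} → i ≤ j → f i ≤ f j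
step-mono-≤ f step {j = zero} z≤n = ≤-refl
step-mono-≤ f step {i} {suc j} i≤1+j with m≤n⇒m<n∨m≡n i≤1+j
... | inj₁ i<1+j = ≤-trans (step-mono-≤ f step (m<1+n⇒m≤n i<1+j)) (step j)
... | inj₂ refl  = ≤-refl

0<F : ∀ i → 0 < F i
0<F zero             = z<s
0<F (suc zero)       = z<s
0<F (suc (suc i))    = <-≤-trans (0<F (suc i)) (m≤m+n _ _)

F[i]≤F[1+i] : ∀ i → F i ≤ F (suc i)
F[i]≤F[1+i] zero    = ≤-refl
F[i]≤F[1+i] (suc i) = m≤m+n _ _

F[1+i]<F[2+i] : ∀ i → F (suc i) < F (2 + i)
F[1+i]<F[2+i] i = m<m+n (F (suc i)) (0<F i)

F-mono-≤ : ∀ {i j} → i ≤ j → F i ≤ F j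
F-mono-≤ = step-mono-≤ F F[i]≤F[1+i]

F-cancel-< : ∀ {i j} → F i < F j → i < j
F-cancel-< Fi<Fj = ≰⇒> (λ j≤i → <⇒≱ Fi<Fj (F-mono-≤ j≤i))

n≤F[n] : ∀ n → n ≤ F n
n≤F[n] zero          = z≤n
n≤F[n] (suc zero)    = ≤-refl
n≤F[n] (suc (suc n)) = ≤-trans (≤-reflexive (+-comm 1 (suc n))) (+-mono-≤ (n≤F[n] (suc n)) (0<F n))

F[3+n]≡F[n]+2F[1+n] : ∀ n → F (3 + n) ≡ F n + 2 * F (1 + n)
F[3+n]≡F[n]+2F[1+n] n = identity (F (1 + n)) (F n)
  where
  identity : ∀ a b → (a + b) + a ≡ b + 2 * a
  identity = solve-∀

F[2+n]+F[n]≡F[1+n]+2F[n] : ∀ n → F (2 + n) + F n ≡ F (1 + n) + 2 * F n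
F[2+n]+F[n]≡F[1+n]+2F[n] n = identity (F (1 + n)) (F n)
  where
  identity : ∀ a b → (a + b) + b ≡ a + 2 * b
  identity = solve-∀

F[4+n]≡F[2+n]+F[n]+2F[1+n] : ∀ n → F (4 + n) ≡ (F (2 + n) + F n) + 2 * F (1 + n)
F[4+n]≡F[2+n]+F[n]+2F[1+n] n = identity (F (1 + n)) (F n)
  where
  identity : ∀ a b → ((a + b) + a) + (a + b) ≡ ((a + b) + b) + 2 * a
  identity = solve-∀

ιscan-fib : ∀ {i x} fuel j d → i ≡ d + j → d < fuel → F i ≡ x → ιscan fuel j x ≡ x
ιscan-fib {x = x} (suc fuel) j zero refl _ Fj≡x with F j ≟ x
... | yes _    = refl
... | no Fj≢x  = ⊥-elim (Fj≢x Fj≡x)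
ιscan-fib {x = x} (suc fuel) j (suc d) refl (s≤s d<fuel) Fi≡x with F j ≟ x
... | yes _ = refl
... | no _ with F j <? x | x <? F (suc j)
...   | yes _ | yes x<F[1+j] =
        ⊥-elim (<⇒≱ x<F[1+j] (≤-trans (F-mono-≤ (s≤s (m≤n+m j d))) (≤-reflexive Fi≡x)))
...   | yes _ | no _ = ιscan-fib fuel (suc j) d (sym (+-suc d j)) d<fuel Fi≡x
...   | no _  | _    = ιscan-fib fuel (suc j) d (sym (+-suc d j)) d<fuel Fi≡x

ιscan-gap : ∀ {i x} fuel j d → i ≡ d + j → d < fuel → F i < x → x < F (suc i) →
            ιscan fuel j x ≡ x ∸ 2 * F (i ∸ 2)
ιscan-gap {x = x} (suc fuel) j zero refl _ Fj<x x<F[1+j] with F j ≟ x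
... | yes Fj≡x = ⊥-elim (<-irrefl Fj≡x Fj<x)
... | no _ with F j <? x | x <? F (suc j)
...   | yes _    | yes _     = refl
...   | no Fj≮x  | _         = ⊥-elim (Fj≮x Fj<x)
...   | yes _    | no x≮F    = ⊥-elim (x≮F x<F[1+j])
ιscan-gap {x = x} (suc fuel) j (suc d) refl (s≤s d<fuel) Fi<x x<F[1+i] with F j ≟ x
... | yes Fj≡x = ⊥-elim (<-irrefl Fj≡x (≤-<-trans (F-mono-≤ (m≤n⇒m≤1+n (m≤n+m j d))) Fi<x))
... | no _ with F j <? x | x <? F (suc j)
...   | yes _ | yes x<F[1+j] = ⊥-elim (<-asym x<F[1+j] (≤-<-trans (F-mono-≤ (s≤s (m≤n+m j d))) Fi<x))
...   | yes _ | no _ = ιscan-gap fuel (suc j) d (sym (+-suc d j)) d<fuel Fi<x x<F[1+i]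
...   | no _  | _    = ιscan-gap fuel (suc j) d (sym (+-suc d j)) d<fuel Fi<x x<F[1+i]

ιbar≡ιscan : ∀ {x} → 0 < x → ιbar x ≡ ιscan (suc x) 0 x
ιbar≡ιscan {suc x} _ = refl

ιbar-fib : ∀ i → ιbar (F i) ≡ F i
ιbar-fib i = trans (ιbar≡ιscan (0<F i))
  (ιscan-fib (suc (F i)) 0 i (sym (+-identityʳ i)) (s≤s (n≤F[n] i)) refl)

ιbar-gap : ∀ {i x} → F i < x → x < F (suc i) → ιbar x ≡ x ∸ 2 * F (i ∸ 2)
ιbar-gap {i} {x} Fi<x x<F[1+i] = trans (ιbar≡ιscan (≤-<-trans z≤n Fi<x))
  (ιscan-gap (suc x) 0 i (sym (+-identityʳ i)) (s≤s (≤-trans (n≤F[n] i) (<⇒≤ Fi<x))) Fi<x x<F[1+i])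

F-bracket : ∀ x → ∃ λ i → F i ≤ suc x × suc x < F (suc i)
F-bracket zero = 1 , ≤-refl , s≤s (s≤s z≤n)
F-bracket (suc x) with F-bracket x
... | i , Fi≤1+x , 1+x<F[1+i] with suc (suc x) <? F (suc i)
...   | yes 2+x<F[1+i] = i , m≤n⇒m≤1+n Fi≤1+x , 2+x<F[1+i]
...   | no 2+x≮F[1+i] =
  suc i , ≤-reflexive F[1+i]≡2+x , subst (_< F (2 + i)) F[1+i]≡2+x (F[1+i]<F[2+i] i)
  where
  F[1+i]≡2+x : F (suc i) ≡ suc (suc x)
  F[1+i]≡2+x = ≤-antisym (≮⇒≥ 2+x≮F[1+i]) 1+x<F[1+i]

suc-∸-< : ∀ m {n} → 0 < n → suc m ∸ n < suc m
suc-∸-< m {suc n} _ = s≤s (m∸n≤m m n)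

ιbar-fixed-or-< : ∀ x → ιbar x ≡ x ⊎ ιbar x < x
ιbar-fixed-or-< zero = inj₁ refl
ιbar-fixed-or-< (suc x) with F-bracket x
... | i , Fi≤1+x , 1+x<F[1+i] with m≤n⇒m<n∨m≡n Fi≤1+x
...   | inj₂ Fi≡1+x = inj₁ (subst (λ y → ιbar y ≡ y) Fi≡1+x (ιbar-fib i))
...   | inj₁ Fi<1+x = inj₂ (subst (_< suc x) (sym (ιbar-gap {i} Fi<1+x 1+x<F[1+i]))
                                 (suc-∸-< x (<-≤-trans (0<F (i ∸ 2)) (m≤m+n _ _))))

iterate-suc : ∀ (f : ℕ → ℕ) k x → iterate f (suc k) x ≡ iterate f k (f x)
iterate-suc f zero    x = refl
iterate-suc f (suc k) x = cong f (iterate-suc f k x)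

iterate-fixed : ∀ (f : ℕ → ℕ) {x} → f x ≡ x → ∀ k → iterate f k x ≡ x
iterate-fixed f fx≡x zero    = refl
iterate-fixed f fx≡x (suc k) = trans (cong f (iterate-fixed f fx≡x k)) fx≡x

alphaIs-ιbar : ∀ {x y} → AlphaIs x y ⇔ AlphaIs (ιbar x) y
alphaIs-ιbar {x} {y} = mk⇔ forward backward
  where
  forward : AlphaIs x y → AlphaIs (ιbar x) y
  forward (K , converges) =
    K , λ k K≤k → trans (sym (iterate-suc ιbar k x)) (converges (suc k) (m≤n⇒m≤1+n K≤k))
  backward : AlphaIs (ιbar x) y → AlphaIs x y
  backward (K , converges) = suc K , λ where
    (suc k) (s≤s K≤k) → trans (iterate-suc ιbar k x) (converges k K≤k)

alphaIs-fixed : ∀ {x y} → ιbar x ≡ x → AlphaIs x y → y ≡ x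
alphaIs-fixed fixed (K , converges) = trans (sym (converges K ≤-refl)) (iterate-fixed ιbar fixed K)

alphaIs-self : ∀ {x} → ιbar x ≡ x → AlphaIs x x
alphaIs-self fixed = 0 , λ k _ → iterate-fixed ιbar fixed k

module InV-properties (ℓ : ℕ) where

  InV-ιbar : ∀ {x} → InV ℓ x ⇔ InV ℓ (ιbar x)
  InV-ιbar = mk⇔ (map₂ (map₁ (to alphaIs-ιbar))) (map₂ (map₁ (from alphaIs-ιbar)))

  InV-fixed : ∀ {x} → ιbar x ≡ x → InV ℓ x ⇔ F ℓ ≤ x
  InV-fixed {x} fixed = mk⇔
    (λ (y , α , Fℓ≤y) → subst (F ℓ ≤_) (alphaIs-fixed fixed α) Fℓ≤y)
    (λ Fℓ≤x → x , alphaIs-self fixed , Fℓ≤x)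

  InV-F : ∀ i → F ℓ ≤ F i → InV ℓ (F i)
  InV-F i = from (InV-fixed (ιbar-fib i))

  InV⇒F≤ : ∀ x → InV ℓ x → F ℓ ≤ x
  InV⇒F≤ = <-rec _ step
    where
    step : ∀ x → (∀ {y} → y < x → InV ℓ y → F ℓ ≤ y) → InV ℓ x → F ℓ ≤ x
    step x below x∈V with ιbar-fixed-or-< x
    ... | inj₁ fixed = to (InV-fixed fixed) x∈V
    ... | inj₂ ιx<x  = ≤-trans (below ιx<x (to InV-ιbar x∈V)) (<⇒≤ ιx<x)

  <F⇒∉InV : ∀ {x} → x < F ℓ → ¬ InV ℓ x
  <F⇒∉InV x<Fℓ x∈V = <⇒≱ x<Fℓ (InV⇒F≤ _ x∈V)

  InV-gap∸ : ∀ j {z} → F (2 + j) < z → z < F (3 + j) → InV ℓ z ⇔ InV ℓ (z ∸ 2 * F j)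
  InV-gap∸ j {z} lo hi = subst (λ w → InV ℓ z ⇔ InV ℓ w) (ιbar-gap {2 + j} lo hi) InV-ιbar

  InV-gap+ : ∀ j {w} → F (2 + j) < w + 2 * F j → w + 2 * F j < F (3 + j) →
             InV ℓ (w + 2 * F j) ⇔ InV ℓ w
  InV-gap+ j {w} lo hi =
    subst (λ v → InV ℓ (w + 2 * F j) ⇔ InV ℓ v) (m+n∸n≡m w (2 * F j)) (InV-gap∸ j lo hi)

  ∉InV-gap : ∀ j {z} → F (2 + j) < z → z < F (3 + j) → z < F ℓ + 2 * F j → ¬ InV ℓ z
  ∉InV-gap j {z} lo hi z<Fℓ+2Fj z∈V = <F⇒∉InV z∸2Fj<Fℓ (to (InV-gap∸ j lo hi) z∈V)
    where
    z∸2Fj<Fℓ : z ∸ 2 * F j < F ℓ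
    z∸2Fj<Fℓ = m<n+o⇒m∸n<o z (2 * F j) {{>-nonZero (0<F ℓ)}}
                 (subst (z <_) (+-comm (F ℓ) _) z<Fℓ+2Fj)

  InV-translate-fib : ∀ n → F ℓ ≤ F n → InV ℓ (F n) ⇔ InV ℓ (F n + 2 * F (1 + n))
  InV-translate-fib n Fℓ≤Fn = subst (λ w → InV ℓ (F n) ⇔ InV ℓ w) (F[3+n]≡F[n]+2F[1+n] n)
    (mk⇔ (λ _ → InV-F (3 + n) (≤-trans Fℓ≤Fn (F-mono-≤ (m≤n+m n 3)))) (λ _ → InV-F n Fℓ≤Fn))

  InV-translate-above : ∀ n {z} → F n < z → z < F (2 + n) + F n →
                        InV ℓ z ⇔ InV ℓ (z + 2 * F (1 + n))
  InV-translate-above n {z} Fn<z z<F[2+n]+F[n] = ⇔-sym (InV-gap+ (1 + n) lo hi)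
    where
    lo : F (3 + n) < z + 2 * F (1 + n)
    lo = subst (_< z + 2 * F (1 + n)) (sym (F[3+n]≡F[n]+2F[1+n] n)) (+-monoˡ-< _ Fn<z)
    hi : z + 2 * F (1 + n) < F (4 + n)
    hi = subst (z + 2 * F (1 + n) <_) (sym (F[4+n]≡F[2+n]+F[n]+2F[1+n] n))
               (+-monoˡ-< _ z<F[2+n]+F[n])

  InV-translate-below : ∀ k {z} → z < F (2 + k) →
                        InV ℓ (z + 2 * F (3 + k)) ⇔ InV ℓ (z + 2 * F (1 + k))
  InV-translate-below k {z} z<F[2+k] = subst (λ w → InV ℓ (z + 2 * F (3 + k)) ⇔ InV ℓ w) undo-shift
                                              (InV-gap∸ (2 + k) lo hi)
    where
    identity : ∀ z a b → z + 2 * (a + b) ≡ (z + 2 * b) + 2 * a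
    identity = solve-∀
    undo-shift : z + 2 * F (3 + k) ∸ 2 * F (2 + k) ≡ z + 2 * F (1 + k)
    undo-shift = trans (cong (_∸ 2 * F (2 + k)) (identity z (F (2 + k)) (F (1 + k))))
                       (m+n∸n≡m (z + 2 * F (1 + k)) (2 * F (2 + k)))
    lo : F (4 + k) < z + 2 * F (3 + k)
    lo = <-≤-trans (+-monoʳ-< (F (3 + k)) (<-≤-trans (F[1+i]<F[2+i] (1 + k)) (m≤m+n _ 0)))
                   (m≤n+m _ z)
    hi : z + 2 * F (3 + k) < F (5 + k)
    hi = subst (z + 2 * F (3 + k) <_) (sym (F[3+n]≡F[n]+2F[1+n] (2 + k))) (+-monoˡ-< _ z<F[2+k])

  InV-F[3+m]+F[1+m] : ∀ m → ℓ ≤ 2 + m → InV ℓ (F (3 + m) + F (1 + m))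
  InV-F[3+m]+F[1+m] m ℓ≤2+m =
    subst (InV ℓ) (sym (F[2+n]+F[n]≡F[1+n]+2F[n] (1 + m)))
      (from (InV-gap+ (1 + m) {F (2 + m)} lo hi) (InV-F (2 + m) (F-mono-≤ ℓ≤2+m)))
    where
    lo : F (3 + m) < F (2 + m) + 2 * F (1 + m)
    lo = +-monoʳ-< (F (2 + m)) (m<m+n _ (<-≤-trans (0<F (1 + m)) (m≤m+n _ 0)))
    hi : F (2 + m) + 2 * F (1 + m) < F (4 + m)
    hi = subst (_< F (4 + m)) (F[2+n]+F[n]≡F[1+n]+2F[n] (1 + m))
               (+-monoʳ-< (F (3 + m)) (F[1+i]<F[2+i] m))

NoneBetween : (ℕ → Set) → ℕ → ℕ → Set
NoneBetween P p q = ∀ z → p < z → z < q → ¬ P z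

Gaps : (ℕ → Set) → ℕ → List ℕ → Set
Gaps P p []       = P p
Gaps P p (a ∷ as) = P p × 0 < a × NoneBetween P p (p + a) × Gaps P (p + a) as

module _ {P : ℕ → Set} where

  gaps-head : ∀ {p} ys → Gaps P p ys → P p
  gaps-head []      p∈P           = p∈P
  gaps-head (_ ∷ _) (p∈P , _)     = p∈P

  gaps-positive : ∀ {p} ys → Gaps P p ys → All (0 <_) ys
  gaps-positive []       _                       = []
  gaps-positive (_ ∷ as) (_ , 0<a , _ , gaps)    = 0<a ∷ gaps-positive as gaps

  gaps-++ : ∀ {p} xs {ys} → Gaps P p xs → Gaps P (p + sum xs) ys → Gaps P p (xs ++ ys)
  gaps-++ {p} []       {ys} p∈P                       gaps =
    subst (λ q → Gaps P q ys) (+-identityʳ p) gaps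
  gaps-++ {p} (a ∷ as) {ys} (p∈P , 0<a , none , gs) gaps =
    p∈P , 0<a , none , gaps-++ as gs (subst (λ q → Gaps P q ys) (sym (+-assoc p a (sum as))) gaps)

  none-translate : ∀ {p q t} → (∀ z → p < z → z < q → P (z + t) → P z) →
                   NoneBetween P p q → NoneBetween P (p + t) (q + t)
  none-translate {p} {q} {t} pull none z p+t<z z<q+t z∈P =
    none w p<w w<q (pull w p<w w<q (subst P (sym (m∸n+n≡m t≤z)) z∈P))
    where
    w : ℕ
    w = z ∸ t
    t≤z : t ≤ z
    t≤z = ≤-trans (m≤n+m t p) (<⇒≤ p+t<z)
    p<w : p < w
    p<w = m+n≤o⇒m≤o∸n (suc p) p+t<z
    w<q : w < q
    w<q = subst (w <_) (m+n∸n≡m q t) (∸-monoˡ-< z<q+t t≤z)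

  gaps-translate : ∀ {p t} ys → (∀ z → p ≤ z → z ≤ p + sum ys → P z ⇔ P (z + t)) →
                   Gaps P p ys → Gaps P (p + t) ys
  gaps-translate {p} [] shift p∈P = to (shift p ≤-refl (≤-reflexive (sym (+-identityʳ p)))) p∈P
  gaps-translate {p} {t} (a ∷ as) shift (p∈P , 0<a , none , gaps) =
    to (shift p ≤-refl (m≤m+n p _)) p∈P ,
    0<a ,
    subst (λ q → NoneBetween P (p + t) q) (xy∙z≈xz∙y p a t)
      (none-translate (λ z p<z z<p+a → from (shift z (<⇒≤ p<z) (z≤p+a+as (<⇒≤ z<p+a)))) none) ,
    subst (λ q → Gaps P q as) (xy∙z≈xz∙y p a t) (gaps-translate as shift′ gaps)
    where
    z≤p+a+as : ∀ {z} → z ≤ p + a → z ≤ p + (a + sum as)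
    z≤p+a+as z≤p+a = ≤-trans z≤p+a (+-monoʳ-≤ p (m≤m+n a (sum as)))
    shift′ : ∀ z → p + a ≤ z → z ≤ p + a + sum as → P z ⇔ P (z + t)
    shift′ z p+a≤z z≤ =
      shift z (≤-trans (m≤m+n p a) p+a≤z) (≤-trans z≤ (≤-reflexive (+-assoc p a (sum as))))

  gaps-partialSum : ∀ {p} ys k → k ≤ length ys → Gaps P p ys → P (p + sum (take k ys))
  gaps-partialSum {p} ys zero _ gaps = subst P (sym (+-identityʳ p)) (gaps-head ys gaps)
  gaps-partialSum {p} (a ∷ as) (suc k) (s≤s k≤) (_ , _ , _ , gaps) =
    subst P (+-assoc p a _) (gaps-partialSum as k k≤ gaps)

  gaps-complete : ∀ {p y} ys → Gaps P p ys → P y → p ≤ y → y ≤ p + sum ys →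
                  ∃ λ k → k ≤ length ys × p + sum (take k ys) ≡ y
  gaps-complete {p} [] _ _ p≤y y≤p+0 =
    0 , z≤n , ≤-antisym (subst (_≤ _) (sym (+-identityʳ p)) p≤y) y≤p+0
  gaps-complete {p} {y} (a ∷ as) (_ , _ , none , gaps) y∈P p≤y y≤ with m≤n⇒m<n∨m≡n p≤y
  ... | inj₂ refl = 0 , z≤n , +-identityʳ p
  ... | inj₁ p<y with y <? p + a
  ...   | yes y<p+a = ⊥-elim (none y p<y y<p+a y∈P)
  ...   | no y≮p+a
          with gaps-complete as gaps y∈P (≮⇒≥ y≮p+a) (≤-trans y≤ (≤-reflexive (sym (+-assoc p a _))))
  ...     | k , k≤ , p+a+Σ≡y = suc k , s≤s k≤ , trans (sym (+-assoc p a _)) p+a+Σ≡y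

Enumerates : (ℕ → Set) → (ℕ → ℕ) → Set
Enumerates P x = StrictlyIncreasing x × (∀ y → P y → ∃ λ i → x i ≡ y) × (∀ i → P (x i))

module Enumeration {P : ℕ → Set} {x : ℕ → ℕ} (x-inc : StrictlyIncreasing x)
                   (x-onto : ∀ y → P y → ∃ λ i → x i ≡ y) (x-into : ∀ i → P (x i)) where

  x-mono-≤ : ∀ {i j} → i ≤ j → x i ≤ x j
  x-mono-≤ = step-mono-≤ x (λ n → <⇒≤ (x-inc n))

  x-cancel-< : ∀ {i j} → x i < x j → i < j
  x-cancel-< xi<xj = ≰⇒> (λ j≤i → <⇒≱ xi<xj (x-mono-≤ j≤i))

  enumeration-least : ∀ {p} → P p → (∀ z → P z → p ≤ z) → x 0 ≡ p
  enumeration-least p∈P p≤ with x-onto _ p∈P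
  ... | i , xi≡p = ≤-antisym (≤-trans (x-mono-≤ z≤n) (≤-reflexive xi≡p)) (p≤ _ (x-into 0))

  enumeration-next : ∀ {j p a} → x j ≡ p → 0 < a → NoneBetween P p (p + a) → P (p + a) →
                     x (suc j) ≡ p + a
  enumeration-next {j} {p} {a} xj≡p 0<a none q∈P with x-onto _ q∈P
  ... | i , xi≡q = ≤-antisym x[1+j]≤q (≮⇒≥ λ x[1+j]<q →
        none (x (suc j)) (subst (_< x (suc j)) xj≡p (x-inc j)) x[1+j]<q (x-into (suc j)))
    where
    x[1+j]≤q : x (suc j) ≤ p + a
    x[1+j]≤q = ≤-trans (x-mono-≤ (x-cancel-< (subst₂ _<_ (sym xj≡p) (sym xi≡q) (m<m+n p 0<a))))
                       (≤-reflexive xi≡q)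

  enumeration-reads-gaps : ∀ {p j} ys → Gaps P p ys → x j ≡ p →
                           ∀ k {a} → nth ys k ≡ just a → x (suc (k + j)) ∸ x (k + j) ≡ a
  enumeration-reads-gaps {p} (b ∷ bs) (_ , 0<b , none , gaps) xj≡p zero refl =
    trans (cong₂ _∸_ (enumeration-next xj≡p 0<b none (gaps-head bs gaps)) xj≡p) (m+n∸m≡n p b)
  enumeration-reads-gaps {j = j} (b ∷ bs) (_ , 0<b , none , gaps) xj≡p (suc k) {a} bs[k]≡a =
    subst (λ i → x (suc i) ∸ x i ≡ a) (+-suc k j)
      (enumeration-reads-gaps bs gaps (enumeration-next xj≡p 0<b none (gaps-head bs gaps))
                              k bs[k]≡a)

length≤sum : ∀ {ys} → All (0 <_) ys → length ys ≤ sum ys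
length≤sum []           = z≤n
length≤sum (0<y ∷ 0<ys) = +-mono-≤ 0<y (length≤sum 0<ys)

sum-take-< : ∀ {ys} k → All (0 <_) ys → k < length ys → sum (take k ys) < sum (take (suc k) ys)
sum-take-< zero    (0<y ∷ _)    _          = <-≤-trans 0<y (m≤m+n _ 0)
sum-take-< (suc k) (_ ∷ 0<ys)   (s≤s k<)   = +-monoʳ-< _ (sum-take-< k 0<ys k<)

take-++ˡ : ∀ {A : Set} k (xs ys : List A) → k ≤ length xs → take k (xs ++ ys) ≡ take k xs
take-++ˡ zero    xs       ys _         = refl
take-++ˡ (suc k) (x ∷ xs) ys (s≤s k≤)  = cong (x ∷_) (take-++ˡ k xs ys k≤)

module _ {P : ℕ → Set} {p : ℕ} (Y : ℕ → List ℕ)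
         (P⇒p≤ : ∀ z → P z → p ≤ z)
         (Y-gaps : ∀ n → Gaps P p (Y n))
         (Y-extends : ∀ n → ∃ λ r → Y (suc n) ≡ Y n ++ r)
         (Y-long : ∀ n → n < length (Y n)) where

  private
    Y-extends-≤ : ∀ {m n} → m ≤ n → ∃ λ r → Y n ≡ Y m ++ r
    Y-extends-≤ {n = zero} z≤n = [] , sym (++-identityʳ _)
    Y-extends-≤ {m} {suc n} m≤1+n with m≤n⇒m<n∨m≡n m≤1+n
    ... | inj₂ refl = [] , sym (++-identityʳ _)
    ... | inj₁ m<1+n with Y-extends-≤ (m<1+n⇒m≤n m<1+n) | Y-extends n
    ...   | r , Yn≡ | s , Y[1+n]≡ = r ++ s , (begin
            Y (suc n)          ≡⟨ Y[1+n]≡ ⟩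
            Y n ++ s           ≡⟨ cong (_++ s) Yn≡ ⟩
            (Y m ++ r) ++ s    ≡⟨ ++-assoc (Y m) r s ⟩
            Y m ++ (r ++ s)    ∎)
      where open ≡-Reasoning

    take-Y : ∀ {m n} k → m ≤ n → k ≤ length (Y m) → take k (Y n) ≡ take k (Y m)
    take-Y {m} k m≤n k≤ with Y-extends-≤ m≤n
    ... | r , Yn≡ = trans (cong (take k) Yn≡) (take-++ˡ k (Y m) r k≤)

  gaps-enumeration : ℕ → ℕ
  gaps-enumeration k = p + sum (take k (Y k))

  gaps-enumeration-enumerates : Enumerates P gaps-enumeration
  gaps-enumeration-enumerates = increasing , onto , into
    where
    increasing : StrictlyIncreasing gaps-enumeration
    increasing k = +-monoʳ-< p (begin-strict
      sum (take k (Y k))           ≡⟨ cong sum (take-Y k (n≤1+n k) (<⇒≤ (Y-long k))) ⟨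
      sum (take k (Y (suc k)))     <⟨ sum-take-< k (gaps-positive (Y (suc k)) (Y-gaps (suc k)))
                                                   (<-trans (n<1+n k) (Y-long (suc k))) ⟩
      sum (take (suc k) (Y (suc k))) ∎)
      where open ≤-Reasoning

    onto : ∀ y → P y → ∃ λ k → gaps-enumeration k ≡ y
    onto y y∈P with gaps-complete (Y y) (Y-gaps y) y∈P (P⇒p≤ y y∈P) y≤p+ΣY
      where
      y≤p+ΣY : y ≤ p + sum (Y y)
      y≤p+ΣY = ≤-trans (<⇒≤ (Y-long y))
                       (≤-trans (length≤sum (gaps-positive (Y y) (Y-gaps y))) (m≤n+m _ p))
    ... | k , k≤ , p+Σ≡y = k , trans (cong (λ ys → p + sum ys) Y-agree) p+Σ≡y
      where
      Y-agree : take k (Y k) ≡ take k (Y y)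
      Y-agree = trans (sym (take-Y k (m≤m+n k y) (<⇒≤ (Y-long k)))) (take-Y k (m≤n+m y k) k≤)

    into : ∀ k → P (gaps-enumeration k)
    into k = gaps-partialSum (Y k) k (<⇒≤ (Y-long k)) (Y-gaps k)

module _ {A : Set} (u v : List A) where

  fibY-extends : ∀ n → ∃ λ r → fibY u v (suc n) ≡ fibY u v n ++ r
  fibY-extends zero    = v , refl
  fibY-extends (suc n) = fibY u v n , refl

  fibY-additive : (h : List A → ℕ) → (∀ xs ys → h (xs ++ ys) ≡ h xs + h ys) →
                  ∀ {k m} → h u ≡ k * F (suc m) → h v ≡ k * F m →
                  ∀ n → h (fibY u v n) ≡ k * F (n + suc m)
  fibY-additive h h-++ {k} {m} hu hv = go
    where
    go : ∀ n → h (fibY u v n) ≡ k * F (n + suc m)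
    go zero          = hu
    go (suc zero)    = trans (h-++ u v) (trans (cong₂ _+_ hu hv) (sym (*-distribˡ-+ k _ _)))
    go (suc (suc n)) = trans (h-++ (fibY u v (suc n)) (fibY u v n))
                             (trans (cong₂ _+_ (go (suc n)) (go n)) (sym (*-distribˡ-+ k _ _)))

module _ (c : ℕ) where

  private
    ℓ X A B : ℕ
    ℓ = 3 + c
    X = F ℓ
    A = F (2 + c)
    B = F (1 + c)

    Y : ℕ → List ℕ
    Y = fibY (A ∷ A ∷ []) (B ∷ B ∷ [])

  open InV-properties ℓ

  -- ℓ ≤ 1 + n is needed only at the endpoint z = F (2 + n) + F n, which then lies in V̄_ℓ
  -- together with z + 2 F (1 + n) = F (4 + n).
  InV-translate : ∀ n {z} → ℓ ≤ suc n → F ℓ ≤ z → z ≤ F (2 + n) + F n →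
                  InV ℓ z ⇔ InV ℓ (z + 2 * F (1 + n))
  InV-translate zero          (s≤s ())
  InV-translate (suc zero)    (s≤s (s≤s ()))
  InV-translate (suc (suc k)) {z} ℓ≤3+k Fℓ≤z z≤end with <-cmp z (F (2 + k)) | m≤n⇒m<n∨m≡n z≤end
  ... | tri< z<F[2+k] _ _ | _ =
    ⇔-trans (InV-translate k ℓ≤1+k Fℓ≤z (≤-trans (<⇒≤ z<F[2+k]) (m≤m+n _ _)))
            (⇔-sym (InV-translate-below k z<F[2+k]))
    where
    ℓ≤1+k : ℓ ≤ suc k
    ℓ≤1+k = m<1+n⇒m≤n (F-cancel-< (≤-<-trans Fℓ≤z z<F[2+k]))
  ... | tri≈ _ refl _ | _ = InV-translate-fib (2 + k) Fℓ≤z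
  ... | tri> _ _ F[2+k]<z | inj₁ z<end = InV-translate-above (2 + k) F[2+k]<z z<end
  ... | tri> _ _ _ | inj₂ refl =
    subst (λ w → InV ℓ z ⇔ InV ℓ w) (F[4+n]≡F[2+n]+F[n]+2F[1+n] (2 + k))
      (mk⇔ (λ _ → InV-F (6 + k) (F-mono-≤ (≤-trans ℓ≤3+k (m≤n+m (3 + k) 3))))
           (λ _ → InV-F[3+m]+F[1+m] (1 + k) ℓ≤3+k))

  private
    0<A : 0 < A
    0<A = 0<F (2 + c)
    0<B : 0 < B
    0<B = 0<F (1 + c)
    A<X : A < X
    A<X = m<m+n A 0<B

    X+A+A≡X+2A : (X + A) + A ≡ X + 2 * A
    X+A+A≡X+2A = identity X A
      where
      identity : ∀ x a → (x + a) + a ≡ x + 2 * a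
      identity = solve-∀

    X+2A+B≡F[5+c] : (X + 2 * A) + B ≡ F (5 + c)
    X+2A+B≡F[5+c] = identity A B
      where
      identity : ∀ a b → ((a + b) + 2 * a) + b ≡ ((a + b) + a) + (a + b)
      identity = solve-∀

    F[5+c]+B≡X+2X : F (5 + c) + B ≡ X + 2 * X
    F[5+c]+B≡X+2X = identity A B
      where
      identity : ∀ a b → (((a + b) + a) + (a + b)) + b ≡ (a + b) + 2 * (a + b)
      identity = solve-∀

  none-X : NoneBetween (InV ℓ) X (X + A)
  none-X z X<z z<X+A = ∉InV-gap (1 + c) X<z z<X+A (<-≤-trans z<X+A (+-monoʳ-≤ X A≤2B))
    where
    A≤2B : A ≤ 2 * B
    A≤2B = +-monoʳ-≤ B (≤-trans (F[i]≤F[1+i] c) (m≤m+n B 0))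

  InV-X+2A : InV ℓ (X + 2 * A)
  InV-X+2A = from (InV-gap+ (2 + c) {X} lo hi) (InV-F ℓ ≤-refl)
    where
    lo : X + A < X + 2 * A
    lo = +-monoʳ-< X (m<m+n A (<-≤-trans 0<A (m≤m+n A 0)))
    hi : X + 2 * A < (X + A) + X
    hi = subst (_< (X + A) + X) X+A+A≡X+2A (+-monoʳ-< (X + A) A<X)

  gaps-AA : Gaps (InV ℓ) X (A ∷ A ∷ [])
  gaps-AA = InV-F ℓ ≤-refl , 0<A , none-X ,
            InV-F (1 + ℓ) (F[i]≤F[1+i] ℓ) , 0<A , none-X+A ,
            subst (InV ℓ) (sym X+A+A≡X+2A) InV-X+2A
    where
    none-X+A : NoneBetween (InV ℓ) (X + A) ((X + A) + A)
    none-X+A z lo hi = ∉InV-gap (2 + c) lo (<-trans hi (+-monoʳ-< (X + A) A<X))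
                                        (subst (z <_) X+A+A≡X+2A hi)

  gaps-BB : Gaps (InV ℓ) (X + 2 * A) (B ∷ B ∷ [])
  gaps-BB = InV-X+2A , 0<B , none-X+2A ,
            subst (λ q → Gaps (InV ℓ) q (B ∷ [])) (sym X+2A+B≡F[5+c])
              (InV-F (5 + c) (F-mono-≤ (m≤n+m ℓ 2)) , 0<B , none-F[5+c] , InV-F[5+c]+B)
    where
    B<F[4+c] : B < F (4 + c)
    B<F[4+c] = <-≤-trans (m<n+m B 0<A) (m≤m+n X A)

    none-X+2A : NoneBetween (InV ℓ) (X + 2 * A) ((X + 2 * A) + B)
    none-X+2A = subst (NoneBetween (InV ℓ) (X + 2 * A)) (xy∙z≈xz∙y X B (2 * A))
      (none-translate pull λ z X<z z<X+B →
        none-X z X<z (<-≤-trans z<X+B (+-monoʳ-≤ X (F[i]≤F[1+i] (1 + c)))))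
      where
      pull : ∀ z → X < z → z < X + B → InV ℓ (z + 2 * A) → InV ℓ z
      pull z X<z z<X+B = to (InV-gap+ (2 + c) lo hi)
        where
        lo : X + A < z + 2 * A
        lo = +-mono-<-≤ X<z (m≤m+n A (A + 0))
        hi : z + 2 * A < F (5 + c)
        hi = subst (z + 2 * A <_) (trans (xy∙z≈xz∙y X B (2 * A)) X+2A+B≡F[5+c])
                   (+-monoˡ-< (2 * A) z<X+B)

    none-F[5+c] : NoneBetween (InV ℓ) (F (5 + c)) (F (5 + c) + B)
    none-F[5+c] z lo hi = ∉InV-gap (3 + c) lo (<-trans hi (+-monoʳ-< (F (5 + c)) B<F[4+c]))
                                   (subst (z <_) F[5+c]+B≡X+2X hi)

    InV-F[5+c]+B : InV ℓ (F (5 + c) + B)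
    InV-F[5+c]+B = subst (InV ℓ) (sym F[5+c]+B≡X+2X)
                         (from (InV-gap+ (3 + c) {X} lo hi) (InV-F ℓ ≤-refl))
      where
      lo : F (5 + c) < X + 2 * X
      lo = subst (F (5 + c) <_) F[5+c]+B≡X+2X (m<m+n _ 0<B)
      hi : X + 2 * X < F (6 + c)
      hi = subst (_< F (6 + c)) F[5+c]+B≡X+2X (+-monoʳ-< (F (5 + c)) B<F[4+c])

  sum-Y : ∀ n → sum (Y n) ≡ 2 * F (n + (2 + c))
  sum-Y = fibY-additive (A ∷ A ∷ []) (B ∷ B ∷ []) sum sum-++ {2} {1 + c} refl refl

  Y-long : ∀ n → n < length (Y n)
  Y-long n = subst (n <_) (sym length-Y)
                   (<-≤-trans (m<m+n n z<s) (≤-trans (n≤F[n] (n + 1)) (m≤m+n _ _)))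
    where
    length-Y : length (Y n) ≡ 2 * F (n + 1)
    length-Y = fibY-additive (A ∷ A ∷ []) (B ∷ B ∷ []) length (λ xs _ → length-++ xs)
                             {2} {0} refl refl n

  gaps-Y : ∀ n → Gaps (InV ℓ) X (Y n)
  gaps-Y zero          = gaps-AA
  gaps-Y (suc zero)    = gaps-++ (A ∷ A ∷ []) {B ∷ B ∷ []} gaps-AA gaps-BB
  gaps-Y (suc (suc n)) =
    gaps-++ (Y (suc n)) (gaps-Y (suc n)) (gaps-translate (Y n) shift (gaps-Y n))
    where
    N : ℕ
    N = n + (2 + c)
    ℓ≤1+N : ℓ ≤ suc N
    ℓ≤1+N = s≤s (m≤n+m (2 + c) n)
    bound : X + sum (Y n) ≤ F (2 + N) + F N
    bound = begin
      X + sum (Y n)          ≡⟨ cong (X +_) (sum-Y n) ⟩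
      X + 2 * F N            ≤⟨ +-monoˡ-≤ (2 * F N) (F-mono-≤ ℓ≤1+N) ⟩
      F (1 + N) + 2 * F N    ≡⟨ F[2+n]+F[n]≡F[1+n]+2F[n] N ⟨
      F (2 + N) + F N        ∎
      where open ≤-Reasoning
    shift : ∀ z → X ≤ z → z ≤ X + sum (Y n) → InV ℓ z ⇔ InV ℓ (z + sum (Y (suc n)))
    shift z X≤z z≤ = subst (λ t → InV ℓ z ⇔ InV ℓ (z + t)) (sym (sum-Y (suc n)))
                           (InV-translate N ℓ≤1+N X≤z (≤-trans z≤ bound))

  InV-enumerable : ∃ λ x → EnumeratesV ℓ x
  InV-enumerable = _ , gaps-enumeration-enumerates Y InV⇒F≤ gaps-Y (fibY-extends _ _) Y-long

  InV-enumeration-fibWord : ∀ x → EnumeratesV ℓ x →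
                       x 0 ≡ F ℓ × IsFibWord (A ∷ A ∷ []) (B ∷ B ∷ []) (λ i → x (suc i) ∸ x i)
  InV-enumeration-fibWord x (x-inc , x-onto , x-into) = x0≡X , reads
    where
    open Enumeration x-inc x-onto x-into
    x0≡X : x 0 ≡ X
    x0≡X = enumeration-least (InV-F ℓ ≤-refl) InV⇒F≤
    reads : IsFibWord (A ∷ A ∷ []) (B ∷ B ∷ []) (λ i → x (suc i) ∸ x i)
    reads n k a Y[k]≡a = subst (λ i → x (suc i) ∸ x i ≡ a) (+-identityʳ k)
                               (enumeration-reads-gaps (Y n) (gaps-Y n) x0≡X k Y[k]≡a)

proposition4p7 : (ℓ : ℕ) → 3 ≤ ℓ →
    (∃ λ x → EnumeratesV ℓ x) ×
    (∀ x → EnumeratesV ℓ x →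
      (x 0 ≡ F ℓ) ×
      IsFibWord (F (ℓ ∸ 1) ∷ F (ℓ ∸ 1) ∷ []) (F (ℓ ∸ 2) ∷ F (ℓ ∸ 2) ∷ [])
        (λ i → x (suc i) ∸ x i))
proposition4p7 (suc (suc (suc c))) (s≤s (s≤s (s≤s z≤n))) =
  InV-enumerable c , InV-enumeration-fibWord c
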